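{- Let $\mathcal{T}_0=\{T^\flat,T^\dagger,T^\ddagger,T^\sharp\}$ and $\mathcal{T}_{k+1}=\{S\otimes T: S,T\in\mathcal{T}_k\}$ for $k\geqslant0$. Let $L$ be a list whose entries belong to $\{T^\flat,T^\dagger,T^\ddagger,T^\sharp\}$, and let $p,q,r,s$ be the numbers of occurrences of $T^\flat,T^\dagger,T^\ddagger,T^\sharp$ in $L$, respectively. If there is an integer $k\geqslant 0$ with $p+q+r+s=2^k$, and $d$ is defined by $d=2p+3q+4r+5s+2^k+k+1$, then $L$ is an elementary decomposition of some $T\in\mathcal{T}_k$ with $\delta(T)=d$.
   Context: Let $S=\{0,1,*\}$; elements of $S^d$ are strings of length $d$. A list is a finite sequence of strings all of the same length (repetitions allowed); $|L|$ is its number of entries; $[x]$ is the one-entry list of the string $x$; $*^m$ is the string of $m$ jokers $*$. Operations: pairing $[v_1,\dots,v_n]\ominus[w_1,\dots,w_n]=[v_1w_1,\dots,v_nw_n]$; concatenation $AB=[v_iw_j]$ (all pairs, ordered lexicographically in $(i,j)$); sum $A+B$ = entries of $A$ followed by entries of $B$; $1\cdot A=A$, $(k+1)\cdot A=k\cdot A+A$; concatenation before sum. For a triple of lists $T=(A,B,C)$: $\alpha(T)$, $\beta(T)$ are the lengths of the strings in $A$, $B$; $\delta(T)=\alpha(T)+\beta(T)$; $g(T)=|C|$. The compound of triples $T=(A,B,C)$, $T'=(A',B',C')$ with $\alpha(T)=\alpha(T')$ is $T\otimes T'=(A'',B'',C'')$ with $A''=[0]A+[0]A'+[1]\big((g(T)g(T'))\cdot[*^{\alpha(T)}]\big)$,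 $B''=[0]B[*^{\beta(T')}]+[1][*^{\beta(T)}]B'+[*]CC'$, $C''=[0]C[*^{\beta(T')}]+[1][*^{\beta(T)}]C'$. Let $G=[0,1]$, $H=[00,01,1*]$, $L_0=[000,001,01*,1**]$. Define $T^\flat=(3\cdot[00]+3\cdot[01]+3\cdot[1*],\ 3\cdot H,\ H)$; $T^\dagger=(4\cdot[00]+4\cdot[01]+4\cdot[1*],\ 3\cdot L_0,\ L_0)$; $T^\ddagger=(2\cdot[00]+2\cdot[01]+3\cdot[00]+3\cdot[01]+6\cdot[1*],\ 2\cdot([0]G[**])+2\cdot([1][*]H)+[*]GH,\ [0]G[**]+[1][*]H)$; $T^\sharp=(2\cdot(3\cdot[00]+3\cdot[01])+9\cdot[1*],\ 2\cdot([0]H[**])+2\cdot([1][**]H)+[*]HH,\ [0]H[**]+[1][**]H)$. Elementary decomposition: for a list $[S_1,\dots,S_{2^k}]$ of triples from $\{T^\flat,T^\dagger,T^\ddagger,T^\sharp\}$ define $\bigotimes[S_1]=S_1$ and, for $k\geqslant1$, $\bigotimes[S_1,\dots,S_{2^k}]=\bigotimes[S_1\otimes S_2,\,S_3\otimes S_4,\,\dots,\,S_{2^k-1}\otimes S_{2^k}]$ (equivalently, the list is indexed by $\{0,1\}^k$ in lexicographic order and entries whose indices differ only in the last place are combined). A list $L$ of length $2^k$ with entries in $\{T^\flat,T^\dagger,T^\ddagger,T^\sharp\}$ is an elementary decomposition of $T$ if $T=\bigotimes L$. -}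

module Defs where

open import Data.Nat using (ℕ; zero; suc; _+_; _*_; _^_)
open import Data.List using (List; []; _∷_; _++_; map; concatMap; replicate; length)
open import Data.Product using (_×_; ∃-syntax)
open import Relation.Binary.PropositionalEquality using (_≡_)

data Sym : Set where
  s0 s1 sj : Sym

Str : Set
Str = List Sym

Lst : Set
Lst = List Str

⟨_⟩ : Str → Lst
⟨ x ⟩ = x ∷ []

jokers : ℕ → Str
jokers m = replicate m sj

infixl 7 _·_
_·_ : Lst → Lst → Lst
A · B = concatMap (λ v → map (λ w → v ++ w) B) A

infixl 6 _⊕_
_⊕_ : Lst → Lst → Lst
A ⊕ B = A ++ B

-- k · A  (1·A = A, (k+1)·A = k·A + A; 0·A is never used, set to [])
infixr 8 _×ₗ_
_×ₗ_ : ℕ → Lst → Lst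
zero ×ₗ A = []
suc k ×ₗ A = (k ×ₗ A) ⊕ A

record Triple : Set where
  constructor ⟪_,_,_⟫
  field
    A B C : Lst
open Triple public

headLen : Lst → ℕ
headLen [] = 0
headLen (x ∷ _) = length x

α : Triple → ℕ
α T = headLen (A T)

β : Triple → ℕ
β T = headLen (B T)

δ : Triple → ℕ
δ T = α T + β T

g : Triple → ℕ
g T = length (C T)

-- compound T ⊗ T' (meaningful when α T ≡ α T')
infixl 5 _⊗_
_⊗_ : Triple → Triple → Triple
T ⊗ T' =
  ⟪ ⟨ s0 ∷ [] ⟩ · A T ⊕ ⟨ s0 ∷ [] ⟩ · A T'
      ⊕ ⟨ s1 ∷ [] ⟩ · ((g T * g T') ×ₗ ⟨ jokers (α T) ⟩)
  , ⟨ s0 ∷ [] ⟩ · B T · ⟨ jokers (β T') ⟩ ⊕ ⟨ s1 ∷ [] ⟩ · ⟨ jokers (β T) ⟩ · B T'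
      ⊕ ⟨ sj ∷ [] ⟩ · C T · C T'
  , ⟨ s0 ∷ [] ⟩ · C T · ⟨ jokers (β T') ⟩ ⊕ ⟨ s1 ∷ [] ⟩ · ⟨ jokers (β T) ⟩ · C T'
  ⟫

G H L₀ : Lst
G = (s0 ∷ []) ∷ (s1 ∷ []) ∷ []
H = (s0 ∷ s0 ∷ []) ∷ (s0 ∷ s1 ∷ []) ∷ (s1 ∷ sj ∷ []) ∷ []
L₀ = (s0 ∷ s0 ∷ s0 ∷ []) ∷ (s0 ∷ s0 ∷ s1 ∷ []) ∷ (s0 ∷ s1 ∷ sj ∷ []) ∷ (s1 ∷ sj ∷ sj ∷ []) ∷ []

[00] [01] [1*] [**] [0] [1] [*] : Lst
[00] = ⟨ s0 ∷ s0 ∷ [] ⟩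
[01] = ⟨ s0 ∷ s1 ∷ [] ⟩
[1*] = ⟨ s1 ∷ sj ∷ [] ⟩
[**] = ⟨ sj ∷ sj ∷ [] ⟩
[0] = ⟨ s0 ∷ [] ⟩
[1] = ⟨ s1 ∷ [] ⟩
[*] = ⟨ sj ∷ [] ⟩

T♭ T† T‡ T♯ : Triple
T♭ = ⟪ 3 ×ₗ [00] ⊕ 3 ×ₗ [01] ⊕ 3 ×ₗ [1*] , 3 ×ₗ H , H ⟫
T† = ⟪ 4 ×ₗ [00] ⊕ 4 ×ₗ [01] ⊕ 4 ×ₗ [1*] , 3 ×ₗ L₀ , L₀ ⟫
T‡ = ⟪ 2 ×ₗ [00] ⊕ 2 ×ₗ [01] ⊕ 3 ×ₗ [00] ⊕ 3 ×ₗ [01] ⊕ 6 ×ₗ [1*]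
     , 2 ×ₗ ([0] · G · [**]) ⊕ 2 ×ₗ ([1] · [*] · H) ⊕ [*] · G · H
     , [0] · G · [**] ⊕ [1] · [*] · H ⟫
T♯ = ⟪ 2 ×ₗ (3 ×ₗ [00] ⊕ 3 ×ₗ [01]) ⊕ 9 ×ₗ [1*]
     , 2 ×ₗ ([0] · H · [**]) ⊕ 2 ×ₗ ([1] · [**] · H) ⊕ [*] · H · H
     , [0] · H · [**] ⊕ [1] · [**] · H ⟫

data Base : Set where
  flat dagger ddagger sharp : Base

⟦_⟧ : Base → Triple
⟦ flat ⟧ = T♭
⟦ dagger ⟧ = T†
⟦ ddagger ⟧ = T‡
⟦ sharp ⟧ = T♯

sameB : Base → Base → ℕ
sameB flat flat = 1
sameB dagger dagger = 1
sameB ddagger ddagger = 1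
sameB sharp sharp = 1
sameB _ _ = 0

occ : Base → List Base → ℕ
occ b [] = 0
occ b (x ∷ xs) = sameB b x + occ b xs

data 𝒯 : ℕ → Triple → Set where
  base : (b : Base) → 𝒯 zero ⟦ b ⟧
  comp : ∀ {k S T} → 𝒯 k S → 𝒯 k T → α S ≡ α T → 𝒯 (suc k) (S ⊗ T)

pairUp : List Triple → List Triple
pairUp (x ∷ y ∷ r) = (x ⊗ y) ∷ pairUp r
pairUp (x ∷ []) = x ∷ []
pairUp [] = []

emptyTriple : Triple
emptyTriple = ⟪ [] , [] , [] ⟫

⨂ : ℕ → List Triple → Triple
⨂ zero (x ∷ _) = x
⨂ zero [] = emptyTriple
⨂ (suc k) L = ⨂ k (pairUp L)

IsElemDecomp : List Base → Triple → Set
IsElemDecomp L T = ∃[ k ] (length L ≡ 2 ^ k × T ≡ ⨂ k (map ⟦_⟧ L))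

-- The two coordinates of a compound grow predictably: α (S ⊗ T) = 1 + α S and
-- β (S ⊗ T) = 1 + β S + β T, as read off the first strings of A and B.  Hence
-- every T ∈ 𝒯_k has α T = k + 2, and β + 1 is additive under ⊗, so the tree of
-- compounds with 2^k leaves S_i has β T + 1 = Σ (β S_i + 1) = Σ β S_i + 2^k.
-- The elementary triples have β = 2, 3, 4, 5, which gives the formula for δ.
module Submission where

open import Defs
open import Data.Nat using (ℕ; zero; suc; _+_; _*_; _^_)
open import Data.Nat.Properties using (suc-injective; 0≢1+n; *-suc; +-suc; +-assoc; +-identityʳ)
open import Data.Nat.ListAction using (sum)
open import Data.Nat.Tactic.RingSolver using (solve-∀)
open import Data.List using (List; []; _∷_; _++_; map; length)
open import Data.List.Properties using (length-++; length-replicate; length-map; map-∘)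
open import Data.List.Relation.Unary.All using (All; []; _∷_; universal)
open import Data.List.Relation.Unary.All.Properties using (map⁺)
open import Data.Product using (_×_; ∃-syntax; _,_)
open import Function using (_∘_)
open import Relation.Binary.PropositionalEquality using (_≡_; _≢_; refl; sym; trans; cong; cong₂; subst; module ≡-Reasoning)

data NonEmpty {X : Set} : List X → Set where
  nonEmpty : ∀ {x xs} → NonEmpty (x ∷ xs)

nonEmpty-++ : ∀ {X Y : Lst} → NonEmpty X → NonEmpty (X ++ Y)
nonEmpty-++ nonEmpty = nonEmpty

nonEmpty-· : ∀ X Y → NonEmpty X → NonEmpty Y → NonEmpty (X · Y)
nonEmpty-· (x ∷ _) (y ∷ _) nonEmpty nonEmpty = nonEmpty

headLen-++ : ∀ {X : Lst} (Y : Lst) → NonEmpty X → headLen (X ++ Y) ≡ headLen X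
headLen-++ _ nonEmpty = refl

headLen-· : ∀ X Y → NonEmpty X → NonEmpty Y → headLen (X · Y) ≡ headLen X + headLen Y
headLen-· (x ∷ _) (y ∷ _) nonEmpty nonEmpty = length-++ x

α-⊗ : ∀ S T → NonEmpty (A S) → α (S ⊗ T) ≡ suc (α S)
α-⊗ S T ne = begin
  headLen (([0] · A S ++ [0] · A T) ++ _)  ≡⟨ headLen-++ _ (nonEmpty-++ [0]·AS-nonEmpty) ⟩
  headLen ([0] · A S ++ [0] · A T)         ≡⟨ headLen-++ _ [0]·AS-nonEmpty ⟩
  headLen ([0] · A S)                      ≡⟨ headLen-· [0] (A S) nonEmpty ne ⟩
  suc (α S)                                ∎
  where
  open ≡-Reasoning
  [0]·AS-nonEmpty : NonEmpty ([0] · A S)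
  [0]·AS-nonEmpty = nonEmpty-· [0] (A S) nonEmpty ne

β-⊗ : ∀ S T → NonEmpty (B S) → β (S ⊗ T) ≡ suc (β S + β T)
β-⊗ S T ne = begin
  headLen ((X ++ _) ++ _)                      ≡⟨ headLen-++ _ (nonEmpty-++ X-nonEmpty) ⟩
  headLen (X ++ _)                             ≡⟨ headLen-++ _ X-nonEmpty ⟩
  headLen X                                    ≡⟨ headLen-· ([0] · B S) _ [0]·BS-nonEmpty nonEmpty ⟩
  headLen ([0] · B S) + length (jokers (β T))  ≡⟨ cong₂ _+_ (headLen-· [0] (B S) nonEmpty ne)
                                                               (length-replicate (β T)) ⟩
  suc (β S + β T)                              ∎
  where
  open ≡-Reasoning
  X : Lst
  X = [0] · B S · ⟨ jokers (β T) ⟩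
  [0]·BS-nonEmpty : NonEmpty ([0] · B S)
  [0]·BS-nonEmpty = nonEmpty-· [0] (B S) nonEmpty ne
  X-nonEmpty : NonEmpty X
  X-nonEmpty = nonEmpty-· ([0] · B S) _ [0]·BS-nonEmpty nonEmpty

𝒯⇒A-nonEmpty : ∀ {k T} → 𝒯 k T → NonEmpty (A T)
𝒯⇒A-nonEmpty (base flat) = nonEmpty
𝒯⇒A-nonEmpty (base dagger) = nonEmpty
𝒯⇒A-nonEmpty (base ddagger) = nonEmpty
𝒯⇒A-nonEmpty (base sharp) = nonEmpty
𝒯⇒A-nonEmpty (comp {S = S} s _ _) = nonEmpty-++ (nonEmpty-++ (nonEmpty-· [0] (A S) nonEmpty (𝒯⇒A-nonEmpty s)))

𝒯⇒B-nonEmpty : ∀ {k T} → 𝒯 k T → NonEmpty (B T)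
𝒯⇒B-nonEmpty (base flat) = nonEmpty
𝒯⇒B-nonEmpty (base dagger) = nonEmpty
𝒯⇒B-nonEmpty (base ddagger) = nonEmpty
𝒯⇒B-nonEmpty (base sharp) = nonEmpty
𝒯⇒B-nonEmpty (comp {S = S} {T} s _ _) =
  nonEmpty-++ (nonEmpty-++
    (nonEmpty-· ([0] · B S) ⟨ jokers (β T) ⟩ (nonEmpty-· [0] (B S) nonEmpty (𝒯⇒B-nonEmpty s)) nonEmpty))

𝒯⇒α≡ : ∀ {k T} → 𝒯 k T → α T ≡ 2 + k
𝒯⇒α≡ (base flat) = refl
𝒯⇒α≡ (base dagger) = refl
𝒯⇒α≡ (base ddagger) = refl
𝒯⇒α≡ (base sharp) = refl
𝒯⇒α≡ (comp {S = S} {T} s _ _) = trans (α-⊗ S T (𝒯⇒A-nonEmpty s)) (cong suc (𝒯⇒α≡ s))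

sucβ : Triple → ℕ
sucβ T = suc (β T)

sucβ-⊗ : ∀ {k} S T → 𝒯 k S → sucβ (S ⊗ T) ≡ sucβ S + sucβ T
sucβ-⊗ S T s = cong suc (trans (β-⊗ S T (𝒯⇒B-nonEmpty s)) (sym (+-suc (β S) (β T))))

comp-same-level : ∀ {k S T} → 𝒯 k S → 𝒯 k T → 𝒯 (suc k) (S ⊗ T)
comp-same-level s t = comp s t (trans (𝒯⇒α≡ s) (sym (𝒯⇒α≡ t)))

2+m≡2[1+n]⇒m≡2n : ∀ {m} n → 2 + m ≡ 2 * suc n → m ≡ 2 * n
2+m≡2[1+n]⇒m≡2n n e = suc-injective (suc-injective (trans e (*-suc 2 n)))

1≢2n : ∀ n → 1 ≢ 2 * n
1≢2n zero ()
1≢2n (suc n) e = 0≢1+n (suc-injective (trans e (*-suc 2 n)))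

length-pairUp : ∀ n Ts → length Ts ≡ 2 * n → length (pairUp Ts) ≡ n
length-pairUp zero [] _ = refl
length-pairUp (suc n) (_ ∷ []) e with () ← 1≢2n (suc n) e
length-pairUp (suc n) (_ ∷ _ ∷ Ts) e = cong suc (length-pairUp n Ts (2+m≡2[1+n]⇒m≡2n n e))

All-𝒯-pairUp : ∀ {k} n Ts → length Ts ≡ 2 * n → All (𝒯 k) Ts → All (𝒯 (suc k)) (pairUp Ts)
All-𝒯-pairUp zero [] _ [] = []
All-𝒯-pairUp (suc n) (_ ∷ []) e _ with () ← 1≢2n (suc n) e
All-𝒯-pairUp (suc n) (_ ∷ _ ∷ Ts) e (s ∷ t ∷ ts) =
  comp-same-level s t ∷ All-𝒯-pairUp n Ts (2+m≡2[1+n]⇒m≡2n n e) ts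

sum-sucβ-pairUp : ∀ {k Ts} → All (𝒯 k) Ts → sum (map sucβ (pairUp Ts)) ≡ sum (map sucβ Ts)
sum-sucβ-pairUp [] = refl
sum-sucβ-pairUp (_ ∷ []) = refl
sum-sucβ-pairUp {Ts = S ∷ T ∷ Ts} (s ∷ _ ∷ ts) = begin
  sucβ (S ⊗ T) + sum (map sucβ (pairUp Ts))  ≡⟨ cong₂ _+_ (sucβ-⊗ S T s) (sum-sucβ-pairUp ts) ⟩
  (sucβ S + sucβ T) + sum (map sucβ Ts)      ≡⟨ +-assoc (sucβ S) (sucβ T) _ ⟩
  sucβ S + (sucβ T + sum (map sucβ Ts))      ∎
  where open ≡-Reasoning

⨂-𝒯 : ∀ k {j Ts} → length Ts ≡ 2 ^ k → All (𝒯 j) Ts → 𝒯 (j + k) (⨂ k Ts)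
⨂-𝒯 zero {j} _ (t ∷ []) = subst (λ i → 𝒯 i _) (sym (+-identityʳ j)) t
⨂-𝒯 (suc k) {j} {Ts} e ts =
  subst (λ i → 𝒯 i (⨂ k (pairUp Ts))) (sym (+-suc j k))
    (⨂-𝒯 k (length-pairUp (2 ^ k) Ts e) (All-𝒯-pairUp (2 ^ k) Ts e ts))

sucβ-⨂ : ∀ k {j Ts} → length Ts ≡ 2 ^ k → All (𝒯 j) Ts → sucβ (⨂ k Ts) ≡ sum (map sucβ Ts)
sucβ-⨂ zero _ (_ ∷ []) = sym (+-identityʳ _)
sucβ-⨂ (suc k) {Ts = Ts} e ts =
  trans (sucβ-⨂ k (length-pairUp (2 ^ k) Ts e) (All-𝒯-pairUp (2 ^ k) Ts e ts)) (sum-sucβ-pairUp ts)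

sum-map-suc : ∀ {X : Set} (f : X → ℕ) xs → sum (map (suc ∘ f) xs) ≡ sum (map f xs) + length xs
sum-map-suc f [] = refl
sum-map-suc f (x ∷ xs) = begin
  suc (f x + sum (map (suc ∘ f) xs))        ≡⟨ cong (λ s → suc (f x + s)) (sum-map-suc f xs) ⟩
  suc (f x + (sum (map f xs) + length xs))  ≡⟨ cong suc (sym (+-assoc (f x) _ _)) ⟩
  suc (f x + sum (map f xs) + length xs)    ≡⟨ sym (+-suc _ (length xs)) ⟩
  f x + sum (map f xs) + suc (length xs)    ∎
  where open ≡-Reasoning

δ-⨂ : ∀ k {Ts} → length Ts ≡ 2 ^ k → All (𝒯 0) Ts → δ (⨂ k Ts) ≡ sum (map β Ts) + 2 ^ k + k + 1
δ-⨂ k {Ts} e ts = begin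
  α T + β T                           ≡⟨ cong (_+ β T) (𝒯⇒α≡ (⨂-𝒯 k e ts)) ⟩
  2 + k + β T                         ≡⟨ 2+k+b≡1+b+k+1 k (β T) ⟩
  sucβ T + k + 1                      ≡⟨ cong (λ s → s + k + 1) (sucβ-⨂ k e ts) ⟩
  sum (map sucβ Ts) + k + 1           ≡⟨ cong (λ s → s + k + 1) (sum-map-suc β Ts) ⟩
  sum (map β Ts) + length Ts + k + 1  ≡⟨ cong (λ n → sum (map β Ts) + n + k + 1) e ⟩
  sum (map β Ts) + 2 ^ k + k + 1      ∎
  where
  open ≡-Reasoning
  T : Triple
  T = ⨂ k Ts
  2+k+b≡1+b+k+1 : ∀ k b → 2 + k + b ≡ suc b + k + 1
  2+k+b≡1+b+k+1 = solve-∀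

length≡Σocc : ∀ L → length L ≡ occ flat L + occ dagger L + occ ddagger L + occ sharp L
length≡Σocc [] = refl
length≡Σocc (b ∷ L) = trans (cong suc (length≡Σocc L)) (count b)
  where
  p q r s : ℕ
  p = occ flat L
  q = occ dagger L
  r = occ ddagger L
  s = occ sharp L
  count : ∀ b → suc (p + q + r + s) ≡ occ flat (b ∷ L) + occ dagger (b ∷ L) + occ ddagger (b ∷ L) + occ sharp (b ∷ L)
  count flat = refl
  count dagger = cong (λ n → n + r + s) (sym (+-suc p q))
  count ddagger = cong (_+ s) (sym (+-suc (p + q) r))
  count sharp = sym (+-suc (p + q + r) s)

sum-map≡Σocc : ∀ (f : Base → ℕ) L →
  sum (map f L) ≡ f flat * occ flat L + f dagger * occ dagger L + f ddagger * occ ddagger L + f sharp * occ sharp L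
sum-map≡Σocc f [] = sym (zeros (f flat) (f dagger) (f ddagger) (f sharp))
  where
  zeros : ∀ a b c d → a * 0 + b * 0 + c * 0 + d * 0 ≡ 0
  zeros = solve-∀
sum-map≡Σocc f (b ∷ L) = trans (cong (f b +_) (sum-map≡Σocc f L)) (count b)
  where
  a₁ a₂ a₃ a₄ p q r s : ℕ
  a₁ = f flat
  a₂ = f dagger
  a₃ = f ddagger
  a₄ = f sharp
  p = occ flat L
  q = occ dagger L
  r = occ ddagger L
  s = occ sharp L
  insert₁ : ∀ a b c d w x y z → a + (a * w + b * x + c * y + d * z) ≡ a * suc w + b * x + c * y + d * z
  insert₁ = solve-∀
  insert₂ : ∀ a b c d w x y z → b + (a * w + b * x + c * y + d * z) ≡ a * w + b * suc x + c * y + d * z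
  insert₂ = solve-∀
  insert₃ : ∀ a b c d w x y z → c + (a * w + b * x + c * y + d * z) ≡ a * w + b * x + c * suc y + d * z
  insert₃ = solve-∀
  insert₄ : ∀ a b c d w x y z → d + (a * w + b * x + c * y + d * z) ≡ a * w + b * x + c * y + d * suc z
  insert₄ = solve-∀
  count : ∀ b → f b + (a₁ * p + a₂ * q + a₃ * r + a₄ * s)
    ≡ a₁ * occ flat (b ∷ L) + a₂ * occ dagger (b ∷ L) + a₃ * occ ddagger (b ∷ L) + a₄ * occ sharp (b ∷ L)
  count flat = insert₁ a₁ a₂ a₃ a₄ p q r s
  count dagger = insert₂ a₁ a₂ a₃ a₄ p q r s
  count ddagger = insert₃ a₁ a₂ a₃ a₄ p q r s
  count sharp = insert₄ a₁ a₂ a₃ a₄ p q r s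

proposition11 : (L : List Base) (k : ℕ)
    → occ flat L + occ dagger L + occ ddagger L + occ sharp L ≡ 2 ^ k
    → ∃[ T ] (𝒯 k T
        × δ T ≡ 2 * occ flat L + 3 * occ dagger L + 4 * occ ddagger L + 5 * occ sharp L + 2 ^ k + k + 1
        × IsElemDecomp L T)
proposition11 L k Σocc≡2^k = ⨂ k Ts , ⨂-𝒯 k |Ts|≡2^k Ts∈𝒯₀ , δ≡ , (k , |L|≡2^k , refl)
  where
  Ts : List Triple
  Ts = map ⟦_⟧ L
  |L|≡2^k : length L ≡ 2 ^ k
  |L|≡2^k = trans (length≡Σocc L) Σocc≡2^k
  |Ts|≡2^k : length Ts ≡ 2 ^ k
  |Ts|≡2^k = trans (length-map ⟦_⟧ L) |L|≡2^k
  Ts∈𝒯₀ : All (𝒯 0) Ts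
  Ts∈𝒯₀ = map⁺ (universal base L)
  δ≡ : δ (⨂ k Ts) ≡ 2 * occ flat L + 3 * occ dagger L + 4 * occ ddagger L + 5 * occ sharp L + 2 ^ k + k + 1
  δ≡ = trans (δ-⨂ k |Ts|≡2^k Ts∈𝒯₀)
             (cong (λ n → n + 2 ^ k + k + 1) (trans (cong sum (sym (map-∘ L))) (sum-map≡Σocc (β ∘ ⟦_⟧) L)))
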